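{- Let $G$ be a graph and let $B,k,s$ be positive integers. Run $\mathrm{ExponentiateAndLocalPrune}(G,B,k,s)$. Then for every $i\in\{0,1,\dots,s\}$ and every $v\in V(G)$, the mapping $\mathrm{map}^{(i)}_v\colon V(T^{(i)}_v)\to V(G)$ is a valid mapping.
   Context: A mapping $\mathrm{map}\colon V(T)\to V(G)$ from a rooted tree is valid if (1) every tree edge $(x,y)$ maps to an edge $\{\mathrm{map}(x),\mathrm{map}(y)\}$ of $G$, and (2) distinct children of the same tree node have distinct images. $\mathrm{LocalPrune}(T,k)$, for a rooted tree $T$ with root $r$: if $r$ has at most $k$ children, return $\{r\}$; otherwise for each child $c$ compute $\mathrm{LocalPrune}(T_c,k)$ ($T_c$ the subtree rooted at $c$), discard the $k$ largest of these (by node count, ties arbitrary), and return $r$ with the remaining pruned subtrees as child subtrees; mappings are restricted to the surviving nodes. $\mathrm{ExponentiateAndLocalPrune}(G,B,k,s)$: Initialization: for each $v$ with $|N_G(v)|<B$, $T^{(0)}_v$ is a root mapped to $v$ with one child mapped to each neighbor of $v$ (distinct children to distinct neighbors), and $v$ is marked active; for each $v$ with $|N_G(v)|\ge B$, $T^{(0)}_v$ is a single node mapped to $v$ and $v$ is marked inactive. For $i=1,\dots,s$: (Prune step) for every $v$, $T^{(i-1)}_{v,\mathrm{pruned}}=\mathrm{LocalPrune}(T^{(i-1)}_v,k)$ with restricted mapping $\mathrm{map}^{(i-1)}_{v,\mathrm{pruned}}$; if $|V(T^{(i-1)}_{v,\mathrm{pruned}})|>\sqrt B$, mark $v$ inactive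 (inactive vertices stay inactive). (Attachment step, after the prune step is done for all $v$) for every $v$: if $v$ is inactive, $T^{(i)}_v=T^{(i-1)}_{v,\mathrm{pruned}}$; otherwise let $x_1,\dots,x_\eta$ be the leaves of $T^{(i-1)}_{v,\mathrm{pruned}}$ at distance exactly $2^{i-1}$ from the root that map to an active vertex, and replace each $x_j$ by a fresh copy of $T^{(i-1)}_{u_j,\mathrm{pruned}}$ with $u_j=\mathrm{map}^{(i-1)}_{v,\mathrm{pruned}}(x_j)$ (the copy's root, which maps to $u_j$, takes the place of $x_j$); the new mapping $\mathrm{map}^{(i)}_v$ agrees with $\mathrm{map}^{(i-1)}_{v,\mathrm{pruned}}$ on the old nodes and with $\mathrm{map}^{(i-1)}_{u_j,\mathrm{pruned}}$ on each attached copy. Output $(T^{(s)}_v,\mathrm{map}^{(s)}_v)$ for all $v$. -}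

module Defs where

open import Data.Bool using (Bool; true; false; if_then_else_; _∧_; not)
open import Data.Nat using (ℕ; zero; suc; _+_; _*_; _^_; _≤_; _<_; _<ᵇ_)
open import Data.Fin using (Fin)
open import Data.List using (List; []; _∷_; map; length; _++_; allFin; filterᵇ)
open import Data.List.Relation.Unary.All using (All)
open import Data.List.Relation.Unary.Unique.Propositional using (Unique)
open import Data.List.Relation.Binary.Pointwise using (Pointwise)
open import Data.List.Relation.Binary.Permutation.Propositional using (_↭_)
open import Relation.Binary.PropositionalEquality using (_≡_)

record Graph : Set where
  field
    n      : ℕ
    adj    : Fin n → Fin n → Bool
    sym    : ∀ u v → adj u v ≡ adj v u
    irrefl : ∀ v → adj v v ≡ false

-- Rooted trees whose nodes carry a label; the label of a node IS its image
-- under the mapping map : V(T) → V(G).  Children form a list (order irrelevant).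
data Tree (V : Set) : Set where
  node : V → List (Tree V) → Tree V

label : ∀ {V} → Tree V → V
label (node a _) = a

mutual
  size : ∀ {V} → Tree V → ℕ
  size (node _ cs) = suc (sizes cs)

  sizes : ∀ {V} → List (Tree V) → ℕ
  sizes [] = 0
  sizes (c ∷ cs) = size c + sizes cs

-- LocalPrune(T,k) as a relation: LocalPrune k T T' means T' is a possible
-- output (ties among equal-sized subtrees broken arbitrarily).
data LocalPrune {V : Set} (k : ℕ) : Tree V → Tree V → Set where
  few  : ∀ {a cs} → length cs ≤ k → LocalPrune k (node a cs) (node a [])
  many : ∀ {a cs cs′ ds ks}
       → k < length cs
       → Pointwise (LocalPrune k) cs cs′
       → cs′ ↭ ds ++ ks
       → length ds ≡ k
       → All (λ d → All (λ e → size e ≤ size d) ks) ds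
       → LocalPrune k (node a cs) (node a ks)

module _ (G : Graph) where
  open Graph G

  data Valid : Tree (Fin n) → Set where
    valid : ∀ {a cs}
          → All (λ c → adj a (label c) ≡ true) cs
          → Unique (map label cs)
          → All Valid cs
          → Valid (node a cs)

  nbrs : Fin n → List (Fin n)
  nbrs v = filterᵇ (adj v) (allFin n)

  mutual
    attach : (Fin n → Bool) → (Fin n → Tree (Fin n)) → ℕ → Tree (Fin n) → Tree (Fin n)
    attach act P zero (node a []) = if act a then P a else node a []
    attach act P zero (node a (c ∷ cs)) = node a (c ∷ cs)
    attach act P (suc d) (node a cs) = node a (attachs act P d cs)

    attachs : (Fin n → Bool) → (Fin n → Tree (Fin n)) → ℕ → List (Tree (Fin n)) → List (Tree (Fin n))
    attachs act P d [] = []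
    attachs act P d (c ∷ cs) = attach act P d c ∷ attachs act P d cs

  record State : Set where
    constructor state
    field
      trees  : Fin n → Tree (Fin n)
      active : Fin n → Bool

  module Algorithm (B k : ℕ) where

    initState : State
    initState = state
      (λ v → if length (nbrs v) <ᵇ B
               then node v (map (λ u → node u []) (nbrs v))
               else node v [])
      (λ v → length (nbrs v) <ᵇ B)

    -- still active after pruning: was active and |V(T_pruned)| ≤ √B,
    -- i.e. not (|V(T_pruned)|^2 > B)
    newActive : State → (Fin n → Tree (Fin n)) → Fin n → Bool
    newActive S P v = State.active S v ∧ not (B <ᵇ size (P v) * size (P v))

    -- Iteration i = j+1 (attachment at distance 2^j = 2^(i-1)), given the
    -- pruned trees P v (any valid outcome of LocalPrune).
    stepResult : State → (Fin n → Tree (Fin n)) → ℕ → State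
    stepResult S P j = state
      (λ v → if newActive S P v
               then attach (newActive S P) P (2 ^ j) (P v)
               else P v)
      (newActive S P)

    data Reach : ℕ → State → Set where
      start : Reach 0 initState
      step  : ∀ {j S} (P : Fin n → Tree (Fin n))
            → Reach j S
            → (∀ v → LocalPrune k (State.trees S v) (P v))
            → Reach (suc j) (stepResult S P j)

{-# OPTIONS --safe #-}
-- Each tree T_v stays valid and keeps its root labelled v.  Pruning keeps
-- the root label and retains only some children, themselves pruned with
-- unchanged root labels, so the edge and distinctness conditions for their
-- parent survive.  Attachment replaces a leaf labelled u by a valid tree
-- whose root is again labelled u, which keeps the edge to the leaf's parent.
module Submission where

open import Defs
open import Data.Nat using (ℕ; _≤_; _<_; zero; suc; _<ᵇ_; _^_)
open import Data.Fin using (Fin)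
open import Data.Bool using (Bool; true; false; T?)
open import Data.Bool.Properties using (T-≡)
open import Data.List using (List; []; _∷_; map; length; _++_; allFin)
open import Data.List.Properties using (map-++; map-∘; map-id)
open import Data.List.Relation.Unary.All as All using (All; []; _∷_)
open import Data.List.Relation.Unary.All.Properties using (all-filter; ++⁻ʳ; map⁺; map⁻)
open import Data.List.Relation.Unary.AllPairs using ([]; _∷_)
open import Data.List.Relation.Unary.Unique.Propositional using (Unique)
open import Data.List.Relation.Unary.Unique.Propositional.Properties using (filter⁺; allFin⁺)
open import Data.List.Relation.Binary.Pointwise as Pointwise using (Pointwise; []; _∷_; Pointwise-≡⇒≡)
open import Data.List.Relation.Binary.Permutation.Propositional using (_↭_; ↭⇒↭ₛ)
open import Data.List.Relation.Binary.Permutation.Propositional.Properties using (All-resp-↭)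
import Data.List.Relation.Binary.Permutation.Propositional.Properties as Perm
import Data.List.Relation.Binary.Permutation.Setoid.Properties as PermSetoid
open import Function.Bundles using (Equivalence)
open import Relation.Binary.PropositionalEquality using (_≡_; refl; sym; trans; cong₂; subst; setoid)

module _ {A : Set} where

  Unique-++⁻ʳ : ∀ xs {ys : List A} → Unique (xs ++ ys) → Unique ys
  Unique-++⁻ʳ []       u       = u
  Unique-++⁻ʳ (_ ∷ xs) (_ ∷ u) = Unique-++⁻ʳ xs u

  Unique-resp-↭ : {xs ys : List A} → xs ↭ ys → Unique xs → Unique ys
  Unique-resp-↭ p = PermSetoid.Unique-resp-↭ (setoid A) (↭⇒↭ₛ p)

module _ {V : Set} {k : ℕ} where

  LocalPrune-label : {t t′ : Tree V} → LocalPrune k t t′ → label t ≡ label t′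
  LocalPrune-label (few _)          = refl
  LocalPrune-label (many _ _ _ _ _) = refl

  LocalPrune-labels : {cs cs′ : List (Tree V)} →
                      Pointwise (LocalPrune k) cs cs′ → map label cs ≡ map label cs′
  LocalPrune-labels pw =
    Pointwise-≡⇒≡ (Pointwise.map⁺ label label (Pointwise.map LocalPrune-label pw))

module _ (G : Graph) where
  open Graph G using (n; adj)

  Valid-resp-child-labels : ∀ {a cs cs′} → map label cs ≡ map label cs′ →
                            All (Valid G) cs′ → Valid G (node a cs) → Valid G (node a cs′)
  Valid-resp-child-labels {a} eq vs′ (valid adjs u _) =
    valid (map⁻ (subst (All (λ x → adj a x ≡ true)) eq (map⁺ adjs)))
          (subst Unique eq u)
          vs′

  Valid-drop-children : ∀ {a cs} ds {ks} → cs ↭ ds ++ ks →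
                        Valid G (node a cs) → Valid G (node a ks)
  Valid-drop-children ds {ks} p (valid adjs u vs) =
    valid (++⁻ʳ ds (All-resp-↭ p adjs))
          (Unique-++⁻ʳ (map label ds)
            (subst Unique (map-++ label ds ks) (Unique-resp-↭ (Perm.map⁺ label p) u)))
          (++⁻ʳ ds (All-resp-↭ p vs))

  module _ {k : ℕ} where
    mutual
      LocalPrune-preserves-Valid : ∀ {t t′} → LocalPrune k t t′ → Valid G t → Valid G t′
      LocalPrune-preserves-Valid (few _) _ = valid [] [] []
      LocalPrune-preserves-Valid (many {ds = ds} _ pw p _ _) vt@(valid _ _ vs) =
        Valid-drop-children ds p
          (Valid-resp-child-labels (LocalPrune-labels pw) (LocalPrune-preserves-All-Valid pw vs) vt)

      LocalPrune-preserves-All-Valid : ∀ {cs cs′} → Pointwise (LocalPrune k) cs cs′ →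
                                       All (Valid G) cs → All (Valid G) cs′
      LocalPrune-preserves-All-Valid []       []       = []
      LocalPrune-preserves-All-Valid (p ∷ ps) (v ∷ vs) =
        LocalPrune-preserves-Valid p v ∷ LocalPrune-preserves-All-Valid ps vs

  record ValidAt (v : Fin n) (t : Tree (Fin n)) : Set where
    field
      isValid : Valid G t
      rooted  : label t ≡ v

  open ValidAt

  ValidFamily : (Fin n → Tree (Fin n)) → Set
  ValidFamily P = ∀ v → ValidAt v (P v)

  LocalPrune-preserves-ValidAt : ∀ {k v t t′} → LocalPrune k t t′ → ValidAt v t → ValidAt v t′
  LocalPrune-preserves-ValidAt p h = record
    { isValid = LocalPrune-preserves-Valid p (isValid h)
    ; rooted  = trans (sym (LocalPrune-label p)) (rooted h)
    }

  module _ (act : Fin n → Bool) {P : Fin n → Tree (Fin n)} (hP : ValidFamily P) where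
    attach-label : ∀ d t → label (attach G act P d t) ≡ label t
    attach-label zero    (node a []) with act a
    ... | true  = rooted (hP a)
    ... | false = refl
    attach-label zero    (node a (_ ∷ _)) = refl
    attach-label (suc d) (node a _)       = refl

    attachs-labels : ∀ d cs → map label cs ≡ map label (attachs G act P d cs)
    attachs-labels d []       = refl
    attachs-labels d (c ∷ cs) = cong₂ _∷_ (sym (attach-label d c)) (attachs-labels d cs)

    mutual
      attach-preserves-Valid : ∀ d t → Valid G t → Valid G (attach G act P d t)
      attach-preserves-Valid zero    (node a []) vt with act a
      ... | true  = isValid (hP a)
      ... | false = vt
      attach-preserves-Valid zero    (node a (_ ∷ _)) vt = vt
      attach-preserves-Valid (suc d) (node a cs) vt@(valid _ _ vs) =
        Valid-resp-child-labels (attachs-labels d cs) (attachs-preserves-All-Valid d cs vs) vt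

      attachs-preserves-All-Valid : ∀ d cs → All (Valid G) cs → All (Valid G) (attachs G act P d cs)
      attachs-preserves-All-Valid d []       []       = []
      attachs-preserves-All-Valid d (c ∷ cs) (v ∷ vs) =
        attach-preserves-Valid d c v ∷ attachs-preserves-All-Valid d cs vs

    attach-preserves-ValidAt : ∀ d {v t} → ValidAt v t → ValidAt v (attach G act P d t)
    attach-preserves-ValidAt d {t = t} h = record
      { isValid = attach-preserves-Valid d t (isValid h)
      ; rooted  = trans (attach-label d t) (rooted h)
      }

  star-Valid : ∀ v (us : List (Fin n)) → All (λ u → adj v u ≡ true) us → Unique us →
               Valid G (node v (map (λ u → node u []) us))
  star-Valid v us adjs u =
    valid (map⁺ adjs)
          (subst Unique (trans (sym (map-id us)) (map-∘ us)) u)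
          (map⁺ (All.universal (λ _ → valid [] [] []) us))

  nbrs-adjacent : ∀ v → All (λ u → adj v u ≡ true) (nbrs G v)
  nbrs-adjacent v = All.map (Equivalence.to T-≡) (all-filter (λ u → T? (adj v u)) (allFin n))

  module _ (B k : ℕ) where
    open Algorithm G B k

    initState-ValidFamily : ValidFamily (State.trees initState)
    initState-ValidFamily v with length (nbrs G v) <ᵇ B
    ... | true  = record { isValid = star-Valid v (nbrs G v) (nbrs-adjacent v) (filter⁺ _ (allFin⁺ n))
                         ; rooted = refl }
    ... | false = record { isValid = valid [] [] [] ; rooted = refl }

    stepResult-ValidFamily : ∀ S {P} j → ValidFamily P → ValidFamily (State.trees (stepResult S P j))
    stepResult-ValidFamily S {P} j hP v with newActive S P v
    ... | true  = attach-preserves-ValidAt (newActive S P) hP (2 ^ j) (hP v)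
    ... | false = hP v

    Reach⇒ValidFamily : ∀ {i S} → Reach i S → ValidFamily (State.trees S)
    Reach⇒ValidFamily start = initState-ValidFamily
    Reach⇒ValidFamily (step {j} {S} P r pruned) =
      stepResult-ValidFamily S j (λ v → LocalPrune-preserves-ValidAt (pruned v) (Reach⇒ValidFamily r v))

mainTheorem6 : (G : Graph) (B k s : ℕ) → 0 < B → 0 < k → 0 < s
    → ∀ (i : ℕ) → i ≤ s
    → ∀ (S : State G) → Algorithm.Reach G B k i S
    → ∀ (v : Fin (Graph.n G)) → Valid G (State.trees S v)
mainTheorem6 G B k _ _ _ _ _ _ _ reach v = ValidAt.isValid (Reach⇒ValidFamily G B k reach v)
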